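{- Let $k\in\mathbb{Z}$ with $k\equiv 2 \pmod{4}$. Then $$\operatorname{Ker}\nu_{\theta^{2k}}=\left\{\begin{pmatrix} a&b\\ c&d\end{pmatrix}\in\Gamma(1)\;\Big|\;\begin{pmatrix} a&b\\ c&d\end{pmatrix}\equiv\begin{pmatrix} 1&0\\ 0&1\end{pmatrix}\pmod 2\right\}.$$ Moreover, $I=\begin{pmatrix} 1&0\\ 0&1\end{pmatrix}$ and $T=\begin{pmatrix} 0&-1\\ 1&0\end{pmatrix}$ form a complete set of coset representatives of $\Gamma_\theta$ modulo $\operatorname{Ker}\nu_{\theta^{2k}}$.
   Context: Let $\Gamma(1)=SL(2,\mathbb{Z})$ and $\Gamma_\theta=\{\begin{pmatrix} a&b\\ c&d\end{pmatrix}\in\Gamma(1): a\equiv d \bmod 2,\ b\equiv c\bmod 2\}$, acting on $\mathscr{H}=\{\tau\in\mathbb{C}:\Im\tau>0\}$ by $M\tau=\frac{a\tau+b}{c\tau+d}$. Let $\theta(\tau)=\sum_{n\in\mathbb{Z}}e^{\pi i n^2\tau}$. For $m\in\mathbb{Z}$, the multiplier system $\nu_{\theta^{2m}}:\Gamma_\theta\to\mathbb{C}^\times$ is defined by $\theta^{2m}(M\tau)=\nu_{\theta^{2m}}(M)(c\tau+d)^m\theta^{2m}(\tau)$ for all $\tau\in\mathscr{H}$, $M=\begin{pmatrix} a&b\\ c&d\end{pmatrix}\in\Gamma_\theta$; it is a character, given explicitly by $\nu_{\theta^{2m}}(M)=e^{ -m\pi i c/2}$ if $b\equiv c\equiv1$,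 $a\equiv d\equiv 0\pmod 2$, and $\nu_{\theta^{2m}}(M)=e^{m\pi i(d-1)/2}$ if $a\equiv d\equiv 1$, $b\equiv c\equiv 0\pmod 2$. $\operatorname{Ker}\nu_{\theta^{2m}}$ denotes its kernel. Matrix congruences are entrywise. -}

module Defs where

open import Data.Integer using (ℤ; +_; -_; _+_; _-_; _*_)
open import Data.Integer.Divisibility using (_∣_)
import Data.Nat.Divisibility as ℕD
open import Data.Integer using (∣_∣)
open import Data.Product using (_×_)
open import Relation.Nullary using (¬_; yes; no)
open import Relation.Binary.PropositionalEquality using (_≡_)

record Mat : Set where
  constructor mat
  field
    a b c d : ℤ
open Mat public

det : Mat → ℤ
det M = a M * d M - b M * c M

_·_ : Mat → Mat → Mat
mat a₁ b₁ c₁ d₁ · mat a₂ b₂ c₂ d₂ =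
  mat (a₁ * a₂ + b₁ * c₂) (a₁ * b₂ + b₁ * d₂)
      (c₁ * a₂ + d₁ * c₂) (c₁ * b₂ + d₁ * d₂)

I : Mat
I = mat (+ 1) (+ 0) (+ 0) (+ 1)

T : Mat
T = mat (+ 0) (- + 1) (+ 1) (+ 0)

_≡_[mod_] : ℤ → ℤ → ℤ → Set
x ≡ y [mod n ] = n ∣ (x - y)

InΓ1 : Mat → Set
InΓ1 M = det M ≡ + 1

InΓθ : Mat → Set
InΓθ M = InΓ1 M × (a M ≡ d M [mod + 2 ]) × (b M ≡ c M [mod + 2 ])

_≡ₘ_[mod_] : Mat → Mat → ℤ → Set
M ≡ₘ N [mod n ] =
  (a M ≡ a N [mod n ]) × (b M ≡ b N [mod n ]) ×
  (c M ≡ c N [mod n ]) × (d M ≡ d N [mod n ])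

-- The multiplier system ν_{θ^{2m}} takes values in the 4th roots of unity;
-- we record it by an exponent e with ν_{θ^{2m}}(M) = i^e, i.e.
--   e^{-mπ i c/2} = i^(-m c)       (case b ≡ c ≡ 1, a ≡ d ≡ 0 mod 2)
--   e^{mπ i (d-1)/2} = i^(m (d-1)) (case a ≡ d ≡ 1, b ≡ c ≡ 0 mod 2)
-- For M ∈ Γ_θ exactly one case holds, distinguished by the parity of b.
νθexp : ℤ → Mat → ℤ
νθexp m M with 2 ℕD.∣? ∣ b M ∣
... | yes _ = m * (d M - + 1)
... | no  _ = - (m * c M)

-- ν_{θ^{2m}}(M) = 1  iff  i^e = 1  iff  4 ∣ e
νθ≡1 : ℤ → Mat → Set
νθ≡1 m M = + 4 ∣ νθexp m M

InKer : ℤ → Mat → Set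
InKer m M = InΓθ M × νθ≡1 m M

-- Reduction mod 2 maps Γ_θ onto {I, T}: the conditions a ≡ d, b ≡ c (mod 2) together
-- with ad − bc = 1 force exactly one of a, b to be odd. If b is even then d is odd, so
-- for even k the exponent k(d − 1) of ν is divisible by 4 and M lies in the kernel; if
-- b is odd then c is odd, and for k ≡ 2 (mod 4) the exponent −kc is ≡ 2 (mod 4), so M
-- does not. Hence the kernel is the class of I, and M ↦ M T⁻¹ maps the class of T into it.
module Submission where

open import Defs
open import Data.Integer using (ℤ; +_; -_; _+_; _-_; _*_; ∣_∣; _%ℕ_; _/ℕ_)
open import Data.Integer.DivMod using (a≡a%ℕn+[a/ℕn]*n; n%ℕd<d)
open import Data.Integer.Divisibility using (_∣_; *-monoʳ-∣)
import Data.Integer.Divisibility.Signed as Signed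
import Data.Integer.Properties as ℤ
open import Data.Integer.Tactic.RingSolver using (solve)
open import Data.List using ([]; _∷_)
import Data.Nat as ℕ
import Data.Nat.Divisibility as ℕ
open import Data.Product using (_×_; _,_; proj₁; Σ)
open import Data.Sum using (_⊎_; inj₁; inj₂)
open import Relation.Nullary using (¬_; yes; no; contradiction)
open import Relation.Nullary.Decidable using (from-no)
open import Relation.Binary.PropositionalEquality
  using (_≡_; refl; sym; trans; cong; subst; module ≡-Reasoning)

private
  variable
    m n x x′ y y′ z : ℤ
    M M′ N : Mat

-- x ≡ y [mod n ] unfolds to divisibility of absolute values, which does not determine
-- x, y and n; this record (and its entrywise extension to matrices) lets Agda infer them.
infix 4 _≈_[mod_] _≈ₘ_[mod_]
record _≈_[mod_] (x y n : ℤ) : Set where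
  constructor ∣-difference⇒≈
  field ∣-difference : n Signed.∣ x - y
open _≈_[mod_]

≈⇒≡mod : x ≈ y [mod n ] → x ≡ y [mod n ]
≈⇒≡mod x≈y = Signed.∣⇒∣ᵤ (∣-difference x≈y)

≡mod⇒≈ : x ≡ y [mod n ] → x ≈ y [mod n ]
≡mod⇒≈ x≡y = ∣-difference⇒≈ (Signed.∣ᵤ⇒∣ x≡y)

≈-from-difference : ∀ {e} → e ≡ x - y → n Signed.∣ e → x ≈ y [mod n ]
≈-from-difference e≡x-y n∣e = ∣-difference⇒≈ (subst (Signed._∣_ _) e≡x-y n∣e)

≈-refl : x ≈ x [mod n ]
≈-refl {x} = ≈-from-difference difference (Signed.divides (+ 0) refl)
  where
  difference : + 0 ≡ x - x
  difference = solve (x ∷ [])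

≈-sym : x ≈ y [mod n ] → y ≈ x [mod n ]
≈-sym {x} {y} x≈y = ≈-from-difference difference (Signed.∣m⇒∣-m (∣-difference x≈y))
  where
  difference : - (x - y) ≡ y - x
  difference = solve (x ∷ y ∷ [])

≈-trans : x ≈ y [mod n ] → y ≈ z [mod n ] → x ≈ z [mod n ]
≈-trans {x} {y} {z = z} x≈y y≈z =
  ≈-from-difference difference (Signed.∣m∣n⇒∣m+n (∣-difference x≈y) (∣-difference y≈z))
  where
  difference : (x - y) + (y - z) ≡ x - z
  difference = solve (x ∷ y ∷ z ∷ [])

+-cong : x ≈ x′ [mod n ] → y ≈ y′ [mod n ] → x + y ≈ x′ + y′ [mod n ]
+-cong {x} {x′} {y = y} {y′} x≈x′ y≈y′ =
  ≈-from-difference difference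
    (Signed.∣m∣n⇒∣m+n (∣-difference x≈x′) (∣-difference y≈y′))
  where
  difference : (x - x′) + (y - y′) ≡ (x + y) - (x′ + y′)
  difference = solve (x ∷ x′ ∷ y ∷ y′ ∷ [])

minus-cong : x ≈ x′ [mod n ] → y ≈ y′ [mod n ] → x - y ≈ x′ - y′ [mod n ]
minus-cong {x} {x′} {y = y} {y′} x≈x′ y≈y′ =
  ≈-from-difference difference
    (Signed.∣m∣n⇒∣m-n (∣-difference x≈x′) (∣-difference y≈y′))
  where
  difference : (x - x′) - (y - y′) ≡ (x - y) - (x′ - y′)
  difference = solve (x ∷ x′ ∷ y ∷ y′ ∷ [])

*-cong : x ≈ x′ [mod n ] → y ≈ y′ [mod n ] → x * y ≈ x′ * y′ [mod n ]
*-cong {x} {x′} {y = y} {y′} x≈x′ y≈y′ =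
  ≈-from-difference difference
    (Signed.∣m∣n⇒∣m+n (Signed.∣m⇒∣m*n y (∣-difference x≈x′))
                      (Signed.∣n⇒∣m*n x′ (∣-difference y≈y′)))
  where
  difference : (x - x′) * y + x′ * (y - y′) ≡ x * y - x′ * y′
  difference = solve (x ∷ x′ ∷ y ∷ y′ ∷ [])

∣-respʳ-≈ : x ≈ y [mod n ] → n ∣ x → n ∣ y
∣-respʳ-≈ {x} {y} x≈y n∣x =
  Signed.∣⇒∣ᵤ (subst (Signed._∣_ _) x-[x-y]≡y
    (Signed.∣m∣n⇒∣m-n (Signed.∣ᵤ⇒∣ {i = x} n∣x) (∣-difference x≈y)))
  where
  x-[x-y]≡y : x - (x - y) ≡ y
  x-[x-y]≡y = solve (x ∷ y ∷ [])

≈-weaken : ∀ {d} → d Signed.∣ n → x ≈ y [mod n ] → x ≈ y [mod d ]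
≈-weaken d∣n x≈y = ∣-difference⇒≈ (Signed.∣-trans d∣n (∣-difference x≈y))

≡+*⇒≈ : ∀ y q n → x ≡ y + q * n → x ≈ y [mod n ]
≡+*⇒≈ y q n refl = ≈-from-difference difference (Signed.divides q refl)
  where
  difference : q * n ≡ (y + q * n) - y
  difference = solve (y ∷ q ∷ n ∷ [])

parity : ∀ x → x ≈ + 0 [mod + 2 ] ⊎ x ≈ + 1 [mod + 2 ]
parity x with x %ℕ 2 | n%ℕd<d x 2 | a≡a%ℕn+[a/ℕn]*n x 2
... | 0 | _ | x≡0+2q = inj₁ (≡+*⇒≈ (+ 0) (x /ℕ 2) (+ 2) x≡0+2q)
... | 1 | _ | x≡1+2q = inj₂ (≡+*⇒≈ (+ 1) (x /ℕ 2) (+ 2) x≡1+2q)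
... | ℕ.suc (ℕ.suc _) | ℕ.s≤s (ℕ.s≤s ()) | _

*-≈2mod4 : m ≈ + 2 [mod + 4 ] → x ≈ + 1 [mod + 2 ] → m * x ≈ + 2 [mod + 4 ]
*-≈2mod4 {m} {x} m≈2 x≈1 =
  ≈-from-difference difference
    (Signed.∣m∣n⇒∣m+n (Signed.∣m⇒∣m*n x (∣-difference m≈2))
                      (Signed.∣ᵤ⇒∣ (*-monoʳ-∣ (+ 2) {x = + 2} {y = x - + 1} (≈⇒≡mod x≈1))))
  where
  difference : (m - + 2) * x + + 2 * (x - + 1) ≡ m * x - + 2
  difference = solve (m ∷ x ∷ [])

2∤1 : ¬ (+ 2 ∣ + 1)
2∤1 = from-no (2 ℕ.∣? 1)

4∤2 : ¬ (+ 4 ∣ + 2)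
4∤2 = from-no (4 ℕ.∣? 2)

≈2mod4⇒2∣ : m ≈ + 2 [mod + 4 ] → + 2 ∣ m
≈2mod4⇒2∣ m≈2 =
  ∣-respʳ-≈ (≈-sym (≈-weaken {d = + 2} (Signed.divides (+ 2) refl) m≈2)) (ℕ.divides 1 refl)

record _≈ₘ_[mod_] (M N : Mat) (n : ℤ) : Set where
  constructor mat-≈
  field
    a≈ : a M ≈ a N [mod n ]
    b≈ : b M ≈ b N [mod n ]
    c≈ : c M ≈ c N [mod n ]
    d≈ : d M ≈ d N [mod n ]

≈ₘ⇒≡ₘ : M ≈ₘ N [mod n ] → M ≡ₘ N [mod n ]
≈ₘ⇒≡ₘ (mat-≈ a≈ b≈ c≈ d≈) = ≈⇒≡mod a≈ , ≈⇒≡mod b≈ , ≈⇒≡mod c≈ , ≈⇒≡mod d≈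

≡ₘ⇒≈ₘ : M ≡ₘ N [mod n ] → M ≈ₘ N [mod n ]
≡ₘ⇒≈ₘ (a≡ , b≡ , c≡ , d≡) = mat-≈ (≡mod⇒≈ a≡) (≡mod⇒≈ b≡) (≡mod⇒≈ c≡) (≡mod⇒≈ d≡)

≈ₘ-refl : M ≈ₘ M [mod n ]
≈ₘ-refl = mat-≈ ≈-refl ≈-refl ≈-refl ≈-refl

det-cong : M ≈ₘ N [mod n ] → det M ≈ det N [mod n ]
det-cong (mat-≈ a≈ b≈ c≈ d≈) = minus-cong (*-cong a≈ d≈) (*-cong b≈ c≈)

·-congʳ : M ≈ₘ M′ [mod n ] → (M · N) ≈ₘ (M′ · N) [mod n ]
·-congʳ (mat-≈ a≈ b≈ c≈ d≈) =
  mat-≈ (+-cong (*-cong a≈ ≈-refl) (*-cong b≈ ≈-refl))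
        (+-cong (*-cong a≈ ≈-refl) (*-cong b≈ ≈-refl))
        (+-cong (*-cong c≈ ≈-refl) (*-cong d≈ ≈-refl))
        (+-cong (*-cong c≈ ≈-refl) (*-cong d≈ ≈-refl))

mat-≡ : ∀ {a b c d a′ b′ c′ d′} → a ≡ a′ → b ≡ b′ → c ≡ c′ → d ≡ d′ →
        mat a b c d ≡ mat a′ b′ c′ d′
mat-≡ refl refl refl refl = refl

·-identityʳ : M · I ≡ M
·-identityʳ {mat a b c d} =
  mat-≡ (solve (a ∷ b ∷ [])) (solve (a ∷ b ∷ [])) (solve (c ∷ d ∷ [])) (solve (c ∷ d ∷ []))

det-· : det (M · N) ≡ det M * det N
det-· {mat a b c d} {mat a′ b′ c′ d′} = begin
  det (mat a b c d · mat a′ b′ c′ d′)                                 ≡⟨⟩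
  (a * a′ + b * c′) * (c * b′ + d * d′) - (a * b′ + b * d′) * (c * a′ + d * c′)
    ≡⟨ solve (a ∷ b ∷ c ∷ d ∷ a′ ∷ b′ ∷ c′ ∷ d′ ∷ []) ⟩
  (a * d - b * c) * (a′ * d′ - b′ * c′)                               ∎
  where open ≡-Reasoning

T⁻¹ : Mat
T⁻¹ = mat (+ 0) (+ 1) (- + 1) (+ 0)

·T⁻¹·T : M ≡ (M · T⁻¹) · T
·T⁻¹·T {mat a b c d} = begin
  mat a b c d                ≡⟨ mat-≡ (solve (a ∷ b ∷ [])) (solve (a ∷ b ∷ []))
                                      (solve (c ∷ d ∷ [])) (solve (c ∷ d ∷ [])) ⟩
  mat (- b) a (- d) c · T    ≡⟨ cong (_· T) M·T⁻¹ ⟨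
  (mat a b c d · T⁻¹) · T    ∎
  where
  open ≡-Reasoning
  M·T⁻¹ : mat a b c d · T⁻¹ ≡ mat (- b) a (- d) c
  M·T⁻¹ = mat-≡ (solve (a ∷ b ∷ [])) (solve (a ∷ b ∷ []))
                (solve (c ∷ d ∷ [])) (solve (c ∷ d ∷ []))

InΓ1-·T⁻¹ : InΓ1 M → InΓ1 (M · T⁻¹)
InΓ1-·T⁻¹ {M} det≡1 = trans (det-· {M}) (trans (ℤ.*-identityʳ (det M)) det≡1)

InΓθ⇒≈ₘI⊎≈ₘT : InΓθ M → M ≈ₘ I [mod + 2 ] ⊎ M ≈ₘ T [mod + 2 ]
InΓθ⇒≈ₘI⊎≈ₘT {M} (det≡1 , a≡d , b≡c) = classify (parity (a M)) (parity (b M))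
  where
  reduce : ∀ {r s} → a M ≈ r [mod + 2 ] → b M ≈ s [mod + 2 ] → M ≈ₘ mat r s s r [mod + 2 ]
  reduce a≈r b≈s = mat-≈ a≈r b≈s (≈-trans (≈-sym (≡mod⇒≈ b≡c)) b≈s)
                                 (≈-trans (≈-sym (≡mod⇒≈ a≡d)) a≈r)

  det-odd : ∀ {r s} → a M ≈ r [mod + 2 ] → b M ≈ s [mod + 2 ] →
            ¬ (det (mat r s s r) ≈ + 0 [mod + 2 ])
  det-odd a≈r b≈s detN≈0 =
    2∤1 (≈⇒≡mod (≈-trans (subst (_≈ _ [mod + 2 ]) det≡1 (det-cong (reduce a≈r b≈s)))
                         detN≈0))

  classify : a M ≈ + 0 [mod + 2 ] ⊎ a M ≈ + 1 [mod + 2 ] →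
             b M ≈ + 0 [mod + 2 ] ⊎ b M ≈ + 1 [mod + 2 ] →
             M ≈ₘ I [mod + 2 ] ⊎ M ≈ₘ T [mod + 2 ]
  classify (inj₂ a≈1) (inj₁ b≈0) = inj₁ (reduce a≈1 b≈0)
  classify (inj₁ a≈0) (inj₂ b≈1) with reduce a≈0 b≈1
  ... | mat-≈ a≈0 b≈1 c≈1 d≈0 = inj₂ (mat-≈ a≈0 (≈-trans b≈1 1≈-1) c≈1 d≈0)
    where
    1≈-1 : + 1 ≈ - + 1 [mod + 2 ]
    1≈-1 = ∣-difference⇒≈ (Signed.divides (+ 1) refl)
  classify (inj₁ a≈0) (inj₁ b≈0) = contradiction ≈-refl (det-odd a≈0 b≈0)
  classify (inj₂ a≈1) (inj₂ b≈1) = contradiction ≈-refl (det-odd a≈1 b≈1)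

νθexp-even : + 2 ∣ b M → νθexp m M ≡ m * (d M - + 1)
νθexp-even {M} 2∣b with 2 ℕ.∣? ∣ b M ∣
... | yes _  = refl
... | no 2∤b = contradiction 2∣b 2∤b

νθexp-odd : ¬ (+ 2 ∣ b M) → νθexp m M ≡ - (m * c M)
νθexp-odd {M} 2∤b with 2 ℕ.∣? ∣ b M ∣
... | yes 2∣b = contradiction 2∣b 2∤b
... | no _    = refl

≈ₘI⇒νθ≡1 : + 2 ∣ m → M ≈ₘ I [mod + 2 ] → νθ≡1 m M
≈ₘI⇒νθ≡1 {m} {M} 2∣m (mat-≈ _ b≈0 _ d≈1) =
  subst (+ 4 ∣_) (sym (νθexp-even {M} 2∣b))
    (subst (ℕ._∣_ 4) (sym (ℤ.abs-* m (d M - + 1))) (ℕ.*-pres-∣ 2∣m (≈⇒≡mod d≈1)))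
  where
  2∣b : + 2 ∣ b M
  2∣b = ∣-respʳ-≈ (≈-sym b≈0) (ℕ.divides 0 refl)

≈ₘT⇒¬νθ≡1 : m ≈ + 2 [mod + 4 ] → M ≈ₘ T [mod + 2 ] → ¬ νθ≡1 m M
≈ₘT⇒¬νθ≡1 {m} {M} m≈2 (mat-≈ _ b≈-1 c≈1 _) 4∣ν = 4∤2 (∣-respʳ-≈ (*-≈2mod4 m≈2 c≈1) 4∣mc)
  where
  2∤b : ¬ (+ 2 ∣ b M)
  2∤b 2∣b = 2∤1 (∣-respʳ-≈ b≈-1 2∣b)

  4∣mc : + 4 ∣ m * c M
  4∣mc = subst (ℕ._∣_ 4) (ℤ.∣-i∣≡∣i∣ (m * c M)) (subst (+ 4 ∣_) (νθexp-odd {M} 2∤b) 4∣ν)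

≈ₘI⇒InΓθ : InΓ1 M → M ≈ₘ I [mod + 2 ] → InΓθ M
≈ₘI⇒InΓθ det≡1 (mat-≈ a≈1 b≈0 c≈0 d≈1) =
  det≡1 , ≈⇒≡mod (≈-trans a≈1 (≈-sym d≈1)) , ≈⇒≡mod (≈-trans b≈0 (≈-sym c≈0))

≈ₘI⇒InKer : + 2 ∣ m → InΓ1 M → M ≈ₘ I [mod + 2 ] → InKer m M
≈ₘI⇒InKer 2∣m det≡1 M≈I = ≈ₘI⇒InΓθ det≡1 M≈I , ≈ₘI⇒νθ≡1 2∣m M≈I

InKer⇒≈ₘI : m ≈ + 2 [mod + 4 ] → InKer m M → M ≈ₘ I [mod + 2 ]
InKer⇒≈ₘI m≈2 (M∈Γθ , ν≡1) with InΓθ⇒≈ₘI⊎≈ₘT M∈Γθ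
... | inj₁ M≈I = M≈I
... | inj₂ M≈T = contradiction ν≡1 (≈ₘT⇒¬νθ≡1 m≈2 M≈T)

Γθ-cosets : + 2 ∣ m → InΓθ M →
  (Σ Mat λ K → InKer m K × M ≡ K · I) ⊎ (Σ Mat λ K → InKer m K × M ≡ K · T)
Γθ-cosets {m} {M} 2∣m M∈Γθ@(det≡1 , _) with InΓθ⇒≈ₘI⊎≈ₘT {M} M∈Γθ
... | inj₁ M≈I = inj₁ (M , ≈ₘI⇒InKer {m} 2∣m det≡1 M≈I , sym ·-identityʳ)
... | inj₂ M≈T =
  inj₂ (M · T⁻¹ , ≈ₘI⇒InKer {m} 2∣m (InΓ1-·T⁻¹ {M} det≡1) (·-congʳ M≈T) , ·T⁻¹·T)

T∉Ker·I : m ≈ + 2 [mod + 4 ] → ¬ (Σ Mat λ K → InKer m K × T ≡ K · I)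
T∉Ker·I {m} m≈2 (K , (_ , ν≡1) , T≡K·I) =
  ≈ₘT⇒¬νθ≡1 m≈2 (≈ₘ-refl {T}) (subst (νθ≡1 m) (sym (trans T≡K·I (·-identityʳ {K}))) ν≡1)

mainTheorem9 : (k : ℤ) → k ≡ + 2 [mod + 4 ] →
    ((M : Mat) → (InKer k M → InΓ1 M × M ≡ₘ I [mod + 2 ])
                × (InΓ1 M × M ≡ₘ I [mod + 2 ] → InKer k M))
    × (InΓθ I × InΓθ T)
    × ((M : Mat) → InΓθ M →
         (Σ Mat λ K → InKer k K × M ≡ K · I) ⊎ (Σ Mat λ K → InKer k K × M ≡ K · T))
    × ¬ (Σ Mat λ K → InKer k K × T ≡ K · I)
mainTheorem9 k k≡2 =
  (λ M → (λ M∈Ker → proj₁ (proj₁ M∈Ker) , ≈ₘ⇒≡ₘ (InKer⇒≈ₘI {M = M} k≈2 M∈Ker)) ,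
         (λ (det≡1 , M≡I) → ≈ₘI⇒InKer 2∣k det≡1 (≡ₘ⇒≈ₘ {M = M} M≡I))) ,
  (≈ₘI⇒InΓθ refl ≈ₘ-refl , (refl , ℕ.divides 0 refl , ℕ.divides 1 refl)) ,
  (λ M → Γθ-cosets {M = M} 2∣k) ,
  T∉Ker·I k≈2
  where
  k≈2 : k ≈ + 2 [mod + 4 ]
  k≈2 = ≡mod⇒≈ k≡2

  2∣k : + 2 ∣ k
  2∣k = ≈2mod4⇒2∣ k≈2
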